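{- Let $p$ be a prime with $p\equiv 1\pmod 3$. Then $p=N_3\big(a+bx+5(Ax+B)\big)$ for some integers $A,B$, where $(a,b)=(1,0),(2,0),(3,1),(4,3)$ according as $p\equiv 1,4,7,13\pmod{15}$. If $p\equiv 7$ or $13\pmod{15}$, then $p=N_3\big(a+bx+5(x-1)(Cx+D)\big)$ for some integers $C,D$, where $(a,b)=(2,3)$ or $(3,-1)$ according as $p\equiv 7$ or $13\pmod{15}$.
   Context: For $F\in\mathbb Z[x]$, $N_3(F)=F(\omega_3)F(\omega_3^2)$ with $\omega_3=e^{2\pi i/3}$. -}

module Defs where

open import Data.Integer using (ℤ; +_; -_; _+_; _*_; _-_)
open import Data.List using (List; []; _∷_)

-- Eisenstein integers ℤ[ω], ω = e^{2πi/3}: the element u + v·ω,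
-- written ⟨ u , v ⟩, with ω² = -1 - ω.
record ℤω : Set where
  constructor ⟨_,_⟩
  field
    re : ℤ
    im : ℤ

open ℤω public

infixl 6 _+ω_
_+ω_ : ℤω → ℤω → ℤω
⟨ a , b ⟩ +ω ⟨ c , d ⟩ = ⟨ a + c , b + d ⟩

infixl 7 _*ω_
-- (a + bω)(c + dω) = ac + (ad + bc)ω + bd ω² = (ac - bd) + (ad + bc - bd)ω
_*ω_ : ℤω → ℤω → ℤω
⟨ a , b ⟩ *ω ⟨ c , d ⟩ = ⟨ a * c - b * d , a * d + b * c - b * d ⟩

ofℤ : ℤ → ℤω
ofℤ n = ⟨ n , + 0 ⟩

ω₃ : ℤω
ω₃ = ⟨ + 0 , + 1 ⟩

-- Polynomials in ℤ[x] as coefficient lists, constant term first.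
Poly : Set
Poly = List ℤ

C : ℤ → Poly
C c = c ∷ []

X : Poly
X = + 0 ∷ + 1 ∷ []

infixl 6 _⊕_
_⊕_ : Poly → Poly → Poly
[] ⊕ g = g
(f ∷ fs) ⊕ [] = f ∷ fs
(f ∷ fs) ⊕ (g ∷ gs) = (f + g) ∷ (fs ⊕ gs)

scale : ℤ → Poly → Poly
scale c [] = []
scale c (f ∷ fs) = (c * f) ∷ scale c fs

infixl 7 _⊗_
_⊗_ : Poly → Poly → Poly
[] ⊗ g = []
(f ∷ fs) ⊗ g = scale f g ⊕ (+ 0 ∷ (fs ⊗ g))

eval : Poly → ℤω → ℤω
eval [] z = ofℤ (+ 0)
eval (f ∷ fs) z = ofℤ f +ω z *ω eval fs z

N₃ : Poly → ℤω
N₃ F = eval F ω₃ *ω eval F (ω₃ *ω ω₃)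

{-# OPTIONS --safe #-}

-- For F ∈ ℤ[x] one has F(ω²) = conj F(ω), so N₃(F) is the norm N(u + vω) = u² − uv + v²
-- of F(ω). A prime p ≡ 1 (mod 3) is such a norm: t ↦ 1/(1 − t) permutes {2, …, p − 1}
-- modulo p with order 3 and 3 ∤ p − 2, so it has a fixed point, i.e. a root m of
-- t² − t + 1 modulo p; Lagrange–Gauss reduction of the
-- form p x² + (2m − 1) x y + ((m² − m + 1)/p) y² of discriminant −3 then yields p = N(π).
-- At x = ω the two polynomial shapes run through α + 5ℤ[ω] and α + 5(ω − 1)ℤ[ω], where
-- α = a + bω. So it suffices that some associate ±ωᵏπ or ±ωᵏπ̄ of π is congruent to α
-- modulo 5, resp. 5(ω − 1). Both conditions only depend on π modulo 15 and the norm of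
-- α is p modulo 15, so they are decided by evaluation over the 225 residue classes.

module Submission where

open import Defs
open import Data.Nat using (ℕ; _%_)
open import Data.Nat.Primality using (Prime)
open import Data.Integer using (ℤ; +_; -_)
open import Data.Product using (∃₂; _×_)
open import Relation.Binary.PropositionalEquality using (_≡_)

open import Data.Bool.Base using (Bool; true; false; T; _∧_; not; if_then_else_)
open import Data.Bool.Properties using (∧-identityʳ; ∧-zeroʳ; T-∧; T-≡)
open import Data.Empty using (⊥-elim)
open import Data.Fin.Base using (Fin)
open import Data.Fin.Patterns using (0F; 1F; 2F; 3F; 4F; 5F)
open import Data.Fin.Properties using (any?)
open import Data.Integer.Base using (_+_; _*_; _-_; ∣_∣; -[1+_]; +[1+_]; sign; _◃_; _%ℕ_; _/ℕ_)
import Data.Integer.Properties as ℤ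
open import Data.Integer.DivMod using (a≡a%ℕn+[a/ℕn]*n; n%ℕd<d)
open import Data.Integer.Divisibility.Signed
  using (_∣_; divides; _∣?_; ∣ᵤ⇒∣; ∣⇒∣ᵤ; ∣m∣n⇒∣m+n; ∣n⇒∣m*n; ∣-trans)
open import Data.Integer.Tactic.RingSolver using (solve-∀)
open import Data.List.Base using ([]; _∷_)
open import Data.Nat.Base as ℕ using (zero; suc; NonZero; _≤_; _<_; z≤n; s≤s)
import Data.Nat.Properties as ℕ
import Data.Nat.Divisibility as ℕ
open import Data.Nat.DivMod using (_/_; m≡m%n+[m/n]*n; [m+kn]%n≡m%n)
open import Data.Nat.Coprimality using (Coprime; coprime-Bézout)
open import Data.Nat.GCD using (module Bézout)
open import Data.Nat.Induction using (<-wellFounded)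
open import Data.Nat.Primality using (prime⇒irreducible; prime⇒nonZero; prime⇒nonTrivial; euclidsLemma)
open import Data.Nat.Tactic.RingSolver renaming (solve-∀ to ℕ-solve-∀)
open import Data.Product using (∃; _,_; proj₁; proj₂)
import Data.Product as Product
open import Data.Sum using (_⊎_; inj₁; inj₂)
import Data.Sum as Sum
open import Function using (_∘_)
open import Function.Bundles using (Equivalence)
open import Induction.WellFounded using (Acc; acc)
open import Relation.Nullary using (¬_; Dec; yes; no; contradiction)
open import Relation.Nullary.Decidable using (T?; _×-dec_; _⊎-dec_; _→-dec_; True; toWitness; map′)
open import Relation.Unary using (Decidable)
open import Relation.Binary.PropositionalEquality
  using (_≢_; refl; sym; trans; cong; cong₂; subst; module ≡-Reasoning)

open ≡-Reasoning

∣-combination : ∀ {n e₁ e₂} → n ∣ e₁ → n ∣ e₂ → ∀ a b {x} → x ≡ a * e₁ + b * e₂ → n ∣ x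
∣-combination n∣e₁ n∣e₂ a b refl = ∣m∣n⇒∣m+n (∣n⇒∣m*n a n∣e₁) (∣n⇒∣m*n b n∣e₂)

∣-residue : ∀ x d .{{_ : NonZero d}} → + d ∣ x - + (x %ℕ d)
∣-residue x d = divides (x /ℕ d) (begin
  x - + r                       ≡⟨ cong (_- + r) (a≡a%ℕn+[a/ℕn]*n x d) ⟩
  + r + (x /ℕ d) * + d - + r    ≡⟨ cancel (+ r) ((x /ℕ d) * + d) ⟩
  (x /ℕ d) * + d                ∎)
  where
  r = x %ℕ d
  cancel : ∀ a b → a + b - a ≡ b
  cancel = solve-∀

congruent-residues⇒≡ : ∀ {d r s} → r < d → s < d → + d ∣ + r - + s → r ≡ s
congruent-residues⇒≡ {d} {r} {s} r<d s<d d∣r-s with ∣ + r - + s ∣ in eq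
... | zero  = ℤ.+-injective (ℤ.i-j≡0⇒i≡j (+ r) (+ s) (ℤ.∣i∣≡0⇒i≡0 eq))
... | suc k = contradiction (subst (d ℕ.∣_) eq (∣⇒∣ᵤ d∣r-s)) (ℕ.>⇒∤ ∣r-s∣<d)
  where
  ∣r-s∣<d : suc k < d
  ∣r-s∣<d = subst (_< d) eq (subst (λ i → ∣ i ∣ < d) (sym (ℤ.m-n≡m⊖n r s))
              (ℕ.≤-<-trans (ℤ.∣m⊝n∣≤m⊔n r s) (ℕ.⊔-lub r<d s<d)))

prime-∣-* : ∀ {p x y} → Prime p → + p ∣ x * y → (+ p ∣ x) ⊎ (+ p ∣ y)
prime-∣-* {p} {x} {y} p-prime p∣xy =
  Sum.map ∣ᵤ⇒∣ ∣ᵤ⇒∣ (euclidsLemma ∣ x ∣ ∣ y ∣ p-prime (subst (p ℕ.∣_) (ℤ.abs-* x y) (∣⇒∣ᵤ p∣xy)))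

prime∤⇒coprime : ∀ {p m} → Prime p → ¬ p ℕ.∣ m → Coprime m p
prime∤⇒coprime p-prime p∤m (d∣m , d∣p) with prime⇒irreducible p-prime d∣p
... | inj₁ d≡1 = d≡1
... | inj₂ refl = contradiction d∣m p∤m

*-sign◃ : ∀ x a → x * (sign x ◃ a) ≡ + a * + ∣ x ∣
*-sign◃ (+ n) a = trans (cong (+ n *_) (ℤ.+◃n≡+n a)) (ℤ.*-comm (+ n) (+ a))
*-sign◃ -[1+ n ] a = trans (cong (-[1+ n ] *_) (ℤ.-◃n≡-n a)) (neg*neg (+ suc n) (+ a))
  where
  neg*neg : ∀ m a → (- m) * (- a) ≡ a * m
  neg*neg = solve-∀

1+m*n≡o*p⇒ℤ : ∀ {m n o p} → 1 ℕ.+ m ℕ.* n ≡ o ℕ.* p → + 1 + + m * + n ≡ + o * + p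
1+m*n≡o*p⇒ℤ {m} {n} {o} {p} eq = begin
  + 1 + + m * + n        ≡⟨ cong (_+_ (+ 1)) (ℤ.pos-* m n) ⟨
  + 1 + + (m ℕ.* n)      ≡⟨ ℤ.pos-+ 1 (m ℕ.* n) ⟨
  + (1 ℕ.+ m ℕ.* n)      ≡⟨ cong +_ eq ⟩
  + (o ℕ.* p)            ≡⟨ ℤ.pos-* o p ⟩
  + o * + p              ∎

inverse : ∀ {p x} → Prime p → ¬ (+ p ∣ x) → ∃ λ w → + p ∣ x * w - + 1
inverse {p} {x} p-prime p∤x with coprime-Bézout (prime∤⇒coprime p-prime (p∤x ∘ ∣ᵤ⇒∣))
... | Bézout.+- a b 1+bp≡a∣x∣ = sign x ◃ a , divides (+ b) (begin
  x * (sign x ◃ a) - + 1   ≡⟨ cong (_- + 1) (*-sign◃ x a) ⟩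
  + a * + ∣ x ∣ - + 1      ≡⟨ cong (_- + 1) (1+m*n≡o*p⇒ℤ {b} {p} {a} {∣ x ∣} 1+bp≡a∣x∣) ⟨
  + 1 + + b * + p - + 1    ≡⟨ cancel (+ b * + p) ⟩
  + b * + p                ∎)
  where
  cancel : ∀ e → + 1 + e - + 1 ≡ e
  cancel = solve-∀
... | Bézout.-+ a b 1+a∣x∣≡bp = - (sign x ◃ a) , divides (- + b) (begin
  x * - (sign x ◃ a) - + 1   ≡⟨ identity x (sign x ◃ a) ⟩
  - (+ 1 + x * (sign x ◃ a)) ≡⟨ cong (λ e → - (+ 1 + e)) (*-sign◃ x a) ⟩
  - (+ 1 + + a * + ∣ x ∣)    ≡⟨ cong -_ (1+m*n≡o*p⇒ℤ {a} {∣ x ∣} {b} {p} 1+a∣x∣≡bp) ⟩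
  - (+ b * + p)              ≡⟨ ℤ.neg-distribˡ-* (+ b) (+ p) ⟩
  - + b * + p                ∎)
  where
  identity : ∀ x w → x * - w - + 1 ≡ - (+ 1 + x * w)
  identity = solve-∀

-- Counting, and permutations of order three without fixed points

count : (ℕ → Bool) → ℕ → ℕ
count S zero    = zero
count S (suc n) = (if S n then 1 else 0) ℕ.+ count S n

count-cong : ∀ {S S′} n → (∀ {t} → t < n → S t ≡ S′ t) → count S n ≡ count S′ n
count-cong zero    _  = refl
count-cong (suc n) eq =
  cong₂ (λ b c → (if b then 1 else 0) ℕ.+ c) (eq (ℕ.n<1+n n)) (count-cong n (eq ∘ ℕ.m<n⇒m<1+n))

count≢0⇒member : ∀ S n → count S n ≢ 0 → ∃ λ t → T (S t)
count≢0⇒member S zero    c≢0 = contradiction refl c≢0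
count≢0⇒member S (suc n) c≢0 with S n in Sn≡true
... | true  = n , subst T (sym Sn≡true) _
... | false = count≢0⇒member S n c≢0

infixl 5 _∖_
_∖_ : (ℕ → Bool) → ℕ → ℕ → Bool
(S ∖ a) t = S t ∧ not (t ℕ.≡ᵇ a)

∖-self : ∀ S a → (S ∖ a) a ≡ false
∖-self S a with a ℕ.≡ᵇ a in a≡ᵇa
... | true  = ∧-zeroʳ (S a)
... | false = contradiction (subst T a≡ᵇa (ℕ.≡⇒≡ᵇ a a refl)) λ ()

∖-other : ∀ S {a t} → t ≢ a → (S ∖ a) t ≡ S t
∖-other S {a} {t} t≢a with t ℕ.≡ᵇ a in t≡ᵇa
... | true  = contradiction (ℕ.≡ᵇ⇒≡ t a (subst T (sym t≡ᵇa) _)) t≢a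
... | false = ∧-identityʳ (S t)

∖-⊆ : ∀ S {a t} → T ((S ∖ a) t) → T (S t)
∖-⊆ S {a} {t} t∈S∖a with t ℕ.≟ a
... | yes refl = contradiction (subst T (∖-self S t) t∈S∖a) λ ()
... | no  t≢a  = subst T (∖-other S t≢a) t∈S∖a

∖-≢ : ∀ S {a t} → T ((S ∖ a) t) → t ≢ a
∖-≢ S t∈S∖a refl = subst T (∖-self S _) t∈S∖a

∈-∖ : ∀ S {a t} → T (S t) → t ≢ a → T ((S ∖ a) t)
∈-∖ S t∈S t≢a = subst T (sym (∖-other S t≢a)) t∈S

count-∖ : ∀ S {a} n → T (S a) → a < n → count S n ≡ suc (count (S ∖ a) n)
count-∖ S {a} (suc n) a∈S a<1+n with ℕ.m<1+n⇒m<n∨m≡n a<1+n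
... | inj₂ refl = begin
  (if S a then 1 else 0) ℕ.+ count S a               ≡⟨ cong (λ b → (if b then 1 else 0) ℕ.+ count S a) (Equivalence.to T-≡ a∈S) ⟩
  suc (count S a)                                    ≡⟨ cong suc (count-cong a (sym ∘ ∖-other S ∘ ℕ.<⇒≢)) ⟩
  suc (count (S ∖ a) a)                              ≡⟨ cong (λ b → suc ((if b then 1 else 0) ℕ.+ count (S ∖ a) a)) (∖-self S a) ⟨
  suc ((if (S ∖ a) a then 1 else 0) ℕ.+ count (S ∖ a) a) ∎
... | inj₁ a<n = begin
  (if S n then 1 else 0) ℕ.+ count S n                 ≡⟨ cong ((if S n then 1 else 0) ℕ.+_) (count-∖ S n a∈S a<n) ⟩
  (if S n then 1 else 0) ℕ.+ suc (count (S ∖ a) n)     ≡⟨ ℕ.+-suc _ _ ⟩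
  suc ((if S n then 1 else 0) ℕ.+ count (S ∖ a) n)     ≡⟨ cong (λ b → suc ((if b then 1 else 0) ℕ.+ count (S ∖ a) n)) (∖-other S (ℕ.>⇒≢ a<n)) ⟨
  suc ((if (S ∖ a) n then 1 else 0) ℕ.+ count (S ∖ a) n) ∎

record Free3Cycle (σ : ℕ → ℕ) (S : ℕ → Bool) : Set where
  field
    closed           : ∀ {t} → T (S t) → T (S (σ t))
    cube             : ∀ {t} → T (S t) → σ (σ (σ t)) ≡ t
    fixed-point-free : ∀ {t} → T (S t) → σ t ≢ t

module _ {σ : ℕ → ℕ} {n : ℕ} where

  Bounded : (ℕ → Bool) → Set
  Bounded S = ∀ {t} → T (S t) → t < n

  private
    orbit-removed : (ℕ → Bool) → ℕ → ℕ → Bool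
    orbit-removed S t = S ∖ t ∖ σ t ∖ σ (σ t)

    orbit-removed-⊆ : ∀ S {t x} → T (orbit-removed S t x) → T (S x)
    orbit-removed-⊆ S {t} = ∖-⊆ S ∘ ∖-⊆ (S ∖ t) ∘ ∖-⊆ (S ∖ t ∖ σ t)

  remove-orbit : ∀ {S t} → Free3Cycle σ S → Bounded S → T (S t) →
                 Free3Cycle σ (orbit-removed S t) × count S n ≡ 3 ℕ.+ count (orbit-removed S t) n
  remove-orbit {S} {t} F bounded t∈S = F′ , size
    where
    open Free3Cycle F
    S₁ = S ∖ t
    S₂ = S₁ ∖ σ t
    S′ = S₂ ∖ σ (σ t)
    σt∈S = closed t∈S
    σσt∈S = closed σt∈S
    σt≢t = fixed-point-free t∈S
    σσt≢σt = fixed-point-free σt∈S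
    σσt≢t : σ (σ t) ≢ t
    σσt≢t σσt≡t = σt≢t (trans (cong σ (sym σσt≡t)) (cube t∈S))
    ⊆S : ∀ {x} → T (S′ x) → T (S x)
    ⊆S = orbit-removed-⊆ S
    size : count S n ≡ 3 ℕ.+ count S′ n
    size = begin
      count S n                    ≡⟨ count-∖ S n t∈S (bounded t∈S) ⟩
      suc (count S₁ n)             ≡⟨ cong suc (count-∖ S₁ n (∈-∖ S σt∈S σt≢t) (bounded σt∈S)) ⟩
      suc (suc (count S₂ n))       ≡⟨ cong (suc ∘ suc) (count-∖ S₂ n (∈-∖ S₁ (∈-∖ S σσt∈S σσt≢t) σσt≢σt) (bounded σσt∈S)) ⟩
      3 ℕ.+ count S′ n             ∎
    closed′ : ∀ {x} → T (S′ x) → T (S′ (σ x))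
    closed′ {x} x∈S′ = ∈-∖ S₂ (∈-∖ S₁ (∈-∖ S (closed x∈S) σx≢t) σx≢σt) σx≢σσt
      where
      x∈S = ⊆S x∈S′
      σ³x≡x : σ (σ (σ x)) ≡ x
      σ³x≡x = cube x∈S
      σx≢t : σ x ≢ t
      σx≢t σx≡t = ∖-≢ S₂ x∈S′ (trans (sym σ³x≡x) (cong (σ ∘ σ) σx≡t))
      σx≢σt : σ x ≢ σ t
      σx≢σt σx≡σt = ∖-≢ S (∖-⊆ S₁ (∖-⊆ S₂ x∈S′)) (trans (sym σ³x≡x) (trans (cong (σ ∘ σ) σx≡σt) (cube t∈S)))
      σx≢σσt : σ x ≢ σ (σ t)
      σx≢σσt σx≡σσt = ∖-≢ S₁ (∖-⊆ S₂ x∈S′) (trans (sym σ³x≡x) (trans (cong (σ ∘ σ) σx≡σσt) (cube σt∈S)))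
    F′ : Free3Cycle σ S′
    F′ = record { closed = closed′ ; cube = cube ∘ ⊆S ; fixed-point-free = fixed-point-free ∘ ⊆S }

  3∣count : ∀ {S} → Free3Cycle σ S → Bounded S → 3 ℕ.∣ count S n
  3∣count {S} F bounded = go F bounded (<-wellFounded (count S n))
    where
    go : ∀ {S} → Free3Cycle σ S → Bounded S → Acc _<_ (count S n) → 3 ℕ.∣ count S n
    go {S} F bounded (acc rec) with count S n ℕ.≟ 0
    ... | yes c≡0 = subst (3 ℕ.∣_) (sym c≡0) (3 ℕ.∣0)
    ... | no  c≢0 with count≢0⇒member S n c≢0
    ...   | t , t∈S with remove-orbit F bounded t∈S
    ...     | F′ , c≡3+c′ = subst (3 ℕ.∣_) (sym c≡3+c′)
                (ℕ.∣m∣n⇒∣m+n ℕ.∣-refl (go {orbit-removed S t} F′ (bounded ∘ orbit-removed-⊆ S)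
                  (rec (subst (count (orbit-removed S t) n <_) (sym c≡3+c′) (ℕ.m<n+m _ {3} (s≤s z≤n))))))

-- A root of t² − t + 1 modulo a prime p ≡ 1 (mod 3)

module _ {p : ℕ} (p-prime : Prime p) where

  private instance
    p≢0 : NonZero p
    p≢0 = prime⇒nonZero p-prime

  1<p : 1 < p
  1<p = ℕ.nonTrivial⇒n>1 p {{prime⇒nonTrivial p-prime}}

  p∤1 : ¬ (+ p ∣ + 1)
  p∤1 = ℕ.>⇒∤ 1<p ∘ ∣⇒∣ᵤ

  private
    -- Junk value 0 when p ∣ x.
    reciprocal′ : ∀ x → Dec (+ p ∣ x) → ℕ
    reciprocal′ x (yes _)   = 0
    reciprocal′ x (no  p∤x) = proj₁ (inverse p-prime p∤x) %ℕ p

    reciprocal′<p : ∀ x d → reciprocal′ x d < p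
    reciprocal′<p x (yes _)   = ℕ.<-trans (s≤s z≤n) 1<p
    reciprocal′<p x (no  p∤x) = n%ℕd<d (proj₁ (inverse p-prime p∤x)) p

    reciprocal′-spec : ∀ x d → ¬ (+ p ∣ x) → + p ∣ x * + reciprocal′ x d - + 1
    reciprocal′-spec x (yes p∣x) p∤x = contradiction p∣x p∤x
    reciprocal′-spec x (no  p∤x) _   =
      ∣-combination (proj₂ (inverse p-prime p∤x)) (∣-residue w p) (+ 1) (- x) (identity x w (+ (w %ℕ p)))
      where
      w = proj₁ (inverse p-prime p∤x)
      identity : ∀ x w r → x * r - + 1 ≡ + 1 * (x * w - + 1) + (- x) * (w - r)
      identity = solve-∀

  reciprocal : ℤ → ℕ
  reciprocal x = reciprocal′ x (+ p ∣? x)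

  reciprocal<p : ∀ x → reciprocal x < p
  reciprocal<p x = reciprocal′<p x (+ p ∣? x)

  reciprocal-spec : ∀ {x} → ¬ (+ p ∣ x) → + p ∣ x * + reciprocal x - + 1
  reciprocal-spec {x} = reciprocal′-spec x (+ p ∣? x)

  S : ℕ → Bool
  S t = (2 ℕ.≤ᵇ t) ∧ (t ℕ.<ᵇ p)

  S-intro : ∀ {t} → 2 ≤ t → t < p → T (S t)
  S-intro 2≤t t<p = Equivalence.from T-∧ (ℕ.≤⇒≤ᵇ 2≤t , ℕ.<⇒<ᵇ t<p)

  S-≥2 : ∀ {t} → T (S t) → 2 ≤ t
  S-≥2 {t} = ℕ.≤ᵇ⇒≤ 2 t ∘ proj₁ ∘ Equivalence.to T-∧

  S-<p : ∀ {t} → T (S t) → t < p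
  S-<p {t} = ℕ.<ᵇ⇒< t p ∘ proj₂ ∘ Equivalence.to T-∧

  σ : ℕ → ℕ
  σ t = reciprocal (+ 1 - + t)

  σ-spec : ∀ {t} → T (S t) → + p ∣ (+ 1 - + t) * + σ t - + 1
  σ-spec {t} t∈S = reciprocal-spec λ p∣1-t →
    ℕ.<-irrefl (congruent-residues⇒≡ 1<p (S-<p t∈S) p∣1-t) (S-≥2 t∈S)

  private
    inverse-∈S : ∀ {t} s → s < p → + p ∣ (+ 1 - + t) * + s - + 1 → T (S t) → T (S s)
    inverse-∈S {t} 0 _ p∣ _ = contradiction (subst (+ p ∣_) (identity (+ t)) (∣n⇒∣m*n (- + 1) p∣)) p∤1
      where
      identity : ∀ t → - + 1 * ((+ 1 - t) * + 0 - + 1) ≡ + 1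
      identity = solve-∀
    inverse-∈S {t} 1 _ p∣ t∈S = contradiction (subst (2 ≤_) t≡0 (S-≥2 t∈S)) λ ()
      where
      identity : ∀ t → - + 1 * ((+ 1 - t) * + 1 - + 1) ≡ t - + 0
      identity = solve-∀
      t≡0 : t ≡ 0
      t≡0 = congruent-residues⇒≡ (S-<p t∈S) (ℕ.<-trans (s≤s z≤n) 1<p)
              (subst (+ p ∣_) (identity (+ t)) (∣n⇒∣m*n (- + 1) p∣))
    inverse-∈S (suc (suc s)) s<p _ _ = S-intro (s≤s (s≤s z≤n)) s<p

  σ-closed : ∀ {t} → T (S t) → T (S (σ t))
  σ-closed {t} t∈S = inverse-∈S (σ t) (reciprocal<p (+ 1 - + t)) (σ-spec t∈S) t∈S

  σ²-spec : ∀ {t} → T (S t) → + p ∣ + t * (+ 1 - + σ (σ t)) - + 1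
  σ²-spec {t} t∈S = ∣-combination (σ-spec t∈S) (σ-spec (σ-closed t∈S)) (+ r) (- (+ r * + t) - (+ t * (+ 1 - + r) - + 1))
    (identity (+ t) (+ σ t) (+ r))
    where
    r = σ (σ t)
    identity : ∀ t s r → t * (+ 1 - r) - + 1 ≡ r * ((+ 1 - t) * s - + 1) + (- (r * t) - (t * (+ 1 - r) - + 1)) * ((+ 1 - s) * r - + 1)
    identity = solve-∀

  σ-cube : ∀ {t} → T (S t) → σ (σ (σ t)) ≡ t
  σ-cube {t} t∈S = Sum.[ ⊥-elim ∘ 1-r≢0 , t≡q ] (prime-∣-* p-prime p∣[1-r][t-q])
    where
    r = σ (σ t)
    q = σ r
    r∈S = σ-closed (σ-closed t∈S)
    p∣[1-r][t-q] : + p ∣ (+ 1 - + r) * (+ t - + q)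
    p∣[1-r][t-q] = ∣-combination (σ²-spec t∈S) (σ-spec r∈S) (+ 1) (- + 1) (identity (+ t) (+ r) (+ q))
      where
      identity : ∀ t r q → (+ 1 - r) * (t - q) ≡ + 1 * (t * (+ 1 - r) - + 1) + (- + 1) * ((+ 1 - r) * q - + 1)
      identity = solve-∀
    1-r≢0 : ¬ (+ p ∣ + 1 - + r)
    1-r≢0 p∣1-r = p∤1 (∣-combination p∣1-r (σ-spec r∈S) (+ q) (- + 1) (identity (+ r) (+ q)))
      where
      identity : ∀ r q → + 1 ≡ q * (+ 1 - r) + (- + 1) * ((+ 1 - r) * q - + 1)
      identity = solve-∀
    t≡q : + p ∣ + t - + q → q ≡ t
    t≡q p∣t-q = sym (congruent-residues⇒≡ (S-<p t∈S) (S-<p (σ-closed r∈S)) p∣t-q)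

  fixed-point⇒root : ∀ {t} → T (S t) → σ t ≡ t → + p ∣ + t * + t - + t + + 1
  fixed-point⇒root {t} t∈S σt≡t =
    subst (+ p ∣_) (identity (+ t)) (∣n⇒∣m*n (- + 1) (subst (λ s → + p ∣ (+ 1 - + t) * + s - + 1) σt≡t (σ-spec t∈S)))
    where
    identity : ∀ t → - + 1 * ((+ 1 - t) * t - + 1) ≡ t * t - t + + 1
    identity = solve-∀

  count-S : count S p ≡ p ℕ.∸ 2
  count-S = trans (count-cong p λ {t} t<p → trans (cong ((2 ℕ.≤ᵇ t) ∧_) (Equivalence.to T-≡ (ℕ.<⇒<ᵇ t<p))) (∧-identityʳ _))
                  (count-≥2 p)
    where
    count-≥2 : ∀ n → count (2 ℕ.≤ᵇ_) n ≡ n ℕ.∸ 2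
    count-≥2 0                   = refl
    count-≥2 1                   = refl
    count-≥2 2                   = refl
    count-≥2 (suc (suc (suc n))) = cong suc (count-≥2 (suc (suc n)))

  root : p % 3 ≡ 1 → ∃ λ m → + p ∣ + m * + m - + m + + 1
  root p%3≡1 with ℕ.anyUpTo? (λ t → T? (S t) ×-dec (σ t ℕ.≟ t)) p
  ... | yes (t , _ , t∈S , σt≡t) = t , fixed-point⇒root t∈S σt≡t
  ... | no  no-fixed-point       = contradiction (subst (3 ℕ.∣_) count-S (3∣count free S-<p)) 3∤p∸2
    where
    free : Free3Cycle σ S
    free = record
      { closed           = σ-closed
      ; cube             = σ-cube
      ; fixed-point-free = λ t∈S σt≡t → no-fixed-point (_ , S-<p t∈S , t∈S , σt≡t)
      }
    3∤p∸2 : ¬ (3 ℕ.∣ p ℕ.∸ 2)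
    3∤p∸2 (ℕ.divides q p∸2≡q*3) = contradiction (begin
      1                    ≡⟨ p%3≡1 ⟨
      p % 3                ≡⟨ cong (_% 3) (ℕ.m+[n∸m]≡n 1<p) ⟨
      (2 ℕ.+ (p ℕ.∸ 2)) % 3 ≡⟨ cong (λ n → (2 ℕ.+ n) % 3) p∸2≡q*3 ⟩
      (2 ℕ.+ q ℕ.* 3) % 3  ≡⟨ [m+kn]%n≡m%n 2 q 3 ⟩
      2                    ∎) λ ()

-- Reduction of binary quadratic forms of discriminant −3

form : ℤ → ℤ → ℤ → ℤ → ℤ → ℤ
form a b c x y = a * x * x + b * x * y + c * y * y

disc : ℤ → ℤ → ℤ → ℤ
disc a b c = b * b - + 4 * a * c

-- The ring solver does not unfold definitions, so identities are stated unfolded in `where` blocks.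
form-shift : ∀ a b c k x y → form a (b - + 2 * a * k) (c - b * k + a * k * k) (x + k * y) y ≡ form a b c x y
form-shift = identity
  where
  identity : ∀ a b c k x y →
    a * (x + k * y) * (x + k * y) + (b - + 2 * a * k) * (x + k * y) * y + (c - b * k + a * k * k) * y * y
      ≡ a * x * x + b * x * y + c * y * y
  identity = solve-∀

disc-shift : ∀ a b c k → disc a (b - + 2 * a * k) (c - b * k + a * k * k) ≡ disc a b c
disc-shift = identity
  where
  identity : ∀ a b c k →
    (b - + 2 * a * k) * (b - + 2 * a * k) - + 4 * a * (c - b * k + a * k * k) ≡ b * b - + 4 * a * c
  identity = solve-∀

form-swap : ∀ a b c x y → form c (- b) a y (- x) ≡ form a b c x y
form-swap = identity
  where
  identity : ∀ a b c x y → c * y * y + (- b) * y * (- x) + a * (- x) * (- x) ≡ a * x * x + b * x * y + c * y * y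
  identity = solve-∀

disc-swap : ∀ a b c → disc c (- b) a ≡ disc a b c
disc-swap = identity
  where
  identity : ∀ a b c → (- b) * (- b) - + 4 * c * a ≡ b * b - + 4 * a * c
  identity = solve-∀

b*b≡+∣b∣*∣b∣ : ∀ b → b * b ≡ + (∣ b ∣ ℕ.* ∣ b ∣)
b*b≡+∣b∣*∣b∣ (+ n)    = sym (ℤ.pos-* n n)
b*b≡+∣b∣*∣b∣ -[1+ n ] = refl

3+b²≡4ac : ∀ a b c → disc a b c ≡ - + 3 → + (3 ℕ.+ ∣ b ∣ ℕ.* ∣ b ∣) ≡ + 4 * a * c
3+b²≡4ac a b c Δ≡-3 = begin
  + (3 ℕ.+ ∣ b ∣ ℕ.* ∣ b ∣)   ≡⟨ ℤ.pos-+ 3 (∣ b ∣ ℕ.* ∣ b ∣) ⟩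
  + 3 + + (∣ b ∣ ℕ.* ∣ b ∣)   ≡⟨ cong (_+_ (+ 3)) (b*b≡+∣b∣*∣b∣ b) ⟨
  + 3 + b * b                  ≡⟨ identity a b c ⟩
  + 4 * a * c + (disc a b c + + 3) ≡⟨ cong (λ Δ → + 4 * a * c + (Δ + + 3)) Δ≡-3 ⟩
  + 4 * a * c + (- + 3 + + 3)  ≡⟨ ℤ.+-identityʳ (+ 4 * a * c) ⟩
  + 4 * a * c                  ∎
  where
  identity : ∀ a b c → + 3 + b * b ≡ + 4 * a * c + ((b * b - + 4 * a * c) + + 3)
  identity = solve-∀

disc≡-3⇒c>0 : ∀ n b c → disc +[1+ n ] b c ≡ - + 3 → ∃ λ m → c ≡ +[1+ m ]
disc≡-3⇒c>0 n b -[1+ k ] Δ≡-3 = contradiction (3+b²≡4ac +[1+ n ] b -[1+ k ] Δ≡-3) λ ()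
disc≡-3⇒c>0 n b (+ 0) Δ≡-3 = contradiction (trans (3+b²≡4ac +[1+ n ] b (+ 0) Δ≡-3) (ℤ.*-zeroʳ (+ 4 * +[1+ n ]))) λ ()
disc≡-3⇒c>0 n b +[1+ m ] Δ≡-3 = m , refl

middle-coefficient : ∀ n b → ∃₂ λ r k → r < 2 ℕ.* suc n × b - + 2 * +[1+ n ] * k ≡ + r - +[1+ n ]
middle-coefficient n b = r , k , n%ℕd<d (b + N) (2 ℕ.* suc n) , (begin
  b - + 2 * N * k                              ≡⟨ identity b N k ⟩
  (b + N) - k * (+ 2 * N) - N                  ≡⟨ cong (λ e → e - k * (+ 2 * N) - N) (a≡a%ℕn+[a/ℕn]*n (b + N) (2 ℕ.* suc n)) ⟩
  (+ r + k * + (2 ℕ.* suc n)) - k * (+ 2 * N) - N ≡⟨ cong (λ e → + r + k * e - k * (+ 2 * N) - N) (ℤ.pos-* 2 (suc n)) ⟩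
  (+ r + k * (+ 2 * N)) - k * (+ 2 * N) - N    ≡⟨ cancel (+ r) (k * (+ 2 * N)) N ⟩
  + r - N                                      ∎)
  where
  N = +[1+ n ]
  r = (b + N) %ℕ (2 ℕ.* suc n)
  k = (b + N) /ℕ (2 ℕ.* suc n)
  identity : ∀ b N k → b - + 2 * N * k ≡ (b + N) - k * (+ 2 * N) - N
  identity = solve-∀
  cancel : ∀ r e N → (r + e) - e - N ≡ r - N
  cancel = solve-∀

record Shifted (n : ℕ) (b c : ℤ) : Set where
  field
    r m     : ℕ
    r<2N    : r < 2 ℕ.* suc n
    disc≡-3 : disc +[1+ n ] (+ r - +[1+ n ]) +[1+ m ] ≡ - + 3
    shift   : ∀ x y → ∃ λ x′ → form +[1+ n ] (+ r - +[1+ n ]) +[1+ m ] x′ y ≡ form +[1+ n ] b c x y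

shift-into-range : ∀ n b c → disc +[1+ n ] b c ≡ - + 3 → Shifted n b c
shift-into-range n b c Δ≡-3 with middle-coefficient n b
... | r , k , r<2N , b′≡ = record
  { r       = r
  ; m       = proj₁ c′>0
  ; r<2N    = r<2N
  ; disc≡-3 = subst (λ c′ → disc N (+ r - N) c′ ≡ - + 3) (proj₂ c′>0) Δ′≡-3
  ; shift   = λ x y → x + k * y , (begin
      form N (+ r - N) +[1+ proj₁ c′>0 ] (x + k * y) y ≡⟨ cong₂ (λ b′ c′ → form N b′ c′ (x + k * y) y) b′≡ (proj₂ c′>0) ⟨
      form N (b - + 2 * N * k) c′ (x + k * y) y       ≡⟨ form-shift N b c k x y ⟩
      form N b c x y                                  ∎)
  }
  where
  N = +[1+ n ]
  c′ = c - b * k + N * k * k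
  Δ′≡-3 : disc N (+ r - N) c′ ≡ - + 3
  Δ′≡-3 = begin
    disc N (+ r - N) c′           ≡⟨ cong (λ b′ → disc N b′ c′) b′≡ ⟨
    disc N (b - + 2 * N * k) c′   ≡⟨ disc-shift N b c k ⟩
    disc N b c                    ≡⟨ Δ≡-3 ⟩
    - + 3                         ∎
  c′>0 : ∃ λ m → c′ ≡ +[1+ m ]
  c′>0 = disc≡-3⇒c>0 n (+ r - N) c′ Δ′≡-3

private
  reduced-form-ℕ : ∀ n f r e → 3 ℕ.* suc n ℕ.* suc n ℕ.+ 4 ℕ.* suc n ℕ.* f ℕ.+ suc e ℕ.* r ≡ 3 → n ≡ 0 × f ≡ 0 × r ≡ 0
  reduced-form-ℕ 0       0       0       e _  = refl , refl , refl
  reduced-form-ℕ 0       0       (suc r) e ()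
  reduced-form-ℕ 0       (suc f) r       e ()
  reduced-form-ℕ (suc n) f       r       e eq = contradiction (trans (sym (expand n f r e)) eq) λ ()
    where
    expand : ∀ n f r e → 3 ℕ.* suc (suc n) ℕ.* suc (suc n) ℕ.+ 4 ℕ.* suc (suc n) ℕ.* f ℕ.+ suc e ℕ.* r
                         ≡ 12 ℕ.+ (3 ℕ.* n ℕ.* n ℕ.+ 12 ℕ.* n ℕ.+ 4 ℕ.* suc (suc n) ℕ.* f ℕ.+ suc e ℕ.* r)
    expand = ℕ-solve-∀

  pos-3nn+4nf+[1+e]r : ∀ n f e r → + (3 ℕ.* n ℕ.* n ℕ.+ 4 ℕ.* n ℕ.* f ℕ.+ suc e ℕ.* r)
                                  ≡ + 3 * + n * + n + + 4 * + n * + f + (+ 1 + + e) * + r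
  pos-3nn+4nf+[1+e]r n f e r = begin
    + (3 ℕ.* n ℕ.* n ℕ.+ 4 ℕ.* n ℕ.* f ℕ.+ suc e ℕ.* r)       ≡⟨ ℤ.pos-+ (3 ℕ.* n ℕ.* n ℕ.+ 4 ℕ.* n ℕ.* f) (suc e ℕ.* r) ⟩
    + (3 ℕ.* n ℕ.* n ℕ.+ 4 ℕ.* n ℕ.* f) + + (suc e ℕ.* r)    ≡⟨ cong (_+ + (suc e ℕ.* r)) (ℤ.pos-+ (3 ℕ.* n ℕ.* n) (4 ℕ.* n ℕ.* f)) ⟩
    + (3 ℕ.* n ℕ.* n) + + (4 ℕ.* n ℕ.* f) + + (suc e ℕ.* r) ≡⟨ cong₂ (λ a b → a + b + + (suc e ℕ.* r)) (pos-*³ 3 n n) (pos-*³ 4 n f) ⟩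
    + 3 * + n * + n + + 4 * + n * + f + + (suc e ℕ.* r)     ≡⟨ cong (_+_ (+ 3 * + n * + n + + 4 * + n * + f)) (ℤ.pos-* (suc e) r) ⟩
    + 3 * + n * + n + + 4 * + n * + f + + suc e * + r       ≡⟨ cong (λ s → + 3 * + n * + n + + 4 * + n * + f + s * + r) (ℤ.pos-+ 1 e) ⟩
    + 3 * + n * + n + + 4 * + n * + f + (+ 1 + + e) * + r    ∎
    where
    pos-*³ : ∀ a b c → + (a ℕ.* b ℕ.* c) ≡ + a * + b * + c
    pos-*³ a b c = trans (ℤ.pos-* (a ℕ.* b) c) (cong (_* + c) (ℤ.pos-* a b))

-- For b = r − n: 4nm − b² = 3n² + 4n(m − n) + r(2n − r), a sum of nonnegative terms.
reduced-form : ∀ {n m r} → n ≤ m → r < 2 ℕ.* suc n → disc +[1+ n ] (+ r - +[1+ n ]) +[1+ m ] ≡ - + 3 →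
               n ≡ 0 × m ≡ 0 × r ≡ 0
reduced-form {n} {m} {r} n≤m r<2N Δ≡-3 with ℕ.m≤n⇒∃[o]m+o≡n n≤m | ℕ.m≤n⇒∃[o]m+o≡n r<2N
... | f , refl | e , 1+r+e≡2N with reduced-form-ℕ n f r e (ℤ.+-injective (begin
    + (3 ℕ.* N ℕ.* N ℕ.+ 4 ℕ.* N ℕ.* f ℕ.+ suc e ℕ.* r)     ≡⟨ pos-3nn+4nf+[1+e]r N f e r ⟩
    + 3 * + N * + N + + 4 * + N * + f + (+ 1 + + e) * + r   ≡⟨ identity (+ N) (+ f) (+ r) (+ e) ⟩
    - disc (+ N) (+ r - + N) (+ N + + f) + + r * ((+ 1 + + r + + e) - + 2 * + N)
      ≡⟨ cong₂ (λ Δ s → - Δ + + r * (s - + 2 * + N)) Δ′≡-3 1+r+e≡2N′ ⟩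
    - - + 3 + + r * (+ 2 * + N - + 2 * + N)                 ≡⟨ cancel (+ r) (+ 2 * + N) ⟩
    + 3                                                     ∎))
  where
  N = suc n
  Δ′≡-3 : disc (+ N) (+ r - + N) (+ N + + f) ≡ - + 3
  Δ′≡-3 = trans (cong (disc (+ N) (+ r - + N)) (ℤ.pos-+ N f)) Δ≡-3
  1+r+e≡2N′ : + 1 + + r + + e ≡ + 2 * + N
  1+r+e≡2N′ = begin
    + 1 + + r + + e       ≡⟨ cong (_+ + e) (ℤ.pos-+ 1 r) ⟨
    + (suc r) + + e       ≡⟨ ℤ.pos-+ (suc r) e ⟨
    + (suc r ℕ.+ e)       ≡⟨ cong +_ 1+r+e≡2N ⟩
    + (2 ℕ.* N)           ≡⟨ ℤ.pos-* 2 N ⟩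
    + 2 * + N             ∎
  cancel : ∀ r a → - - + 3 + r * (a - a) ≡ + 3
  cancel = solve-∀
  identity : ∀ N F R E → + 3 * N * N + + 4 * N * F + (+ 1 + E) * R
                         ≡ - ((R - N) * (R - N) - + 4 * N * (N + F)) + R * ((+ 1 + R + E) - + 2 * N)
  identity = solve-∀
... | n≡0 , f≡0 , r≡0 = n≡0 , trans (cong (n ℕ.+_) f≡0) (trans (ℕ.+-identityʳ n) n≡0) , r≡0

principal-form : ∀ {n m r} → n ≡ 0 × m ≡ 0 × r ≡ 0 → ∀ x y →
            form (+ 1) (- + 1) (+ 1) x y ≡ form +[1+ n ] (+ r - +[1+ n ]) +[1+ m ] x y
principal-form (refl , refl , refl) x y = refl

reduce : ∀ n → Acc _<_ n → ∀ b c x y → disc +[1+ n ] b c ≡ - + 3 →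
         ∃₂ λ u v → form (+ 1) (- + 1) (+ 1) u v ≡ form +[1+ n ] b c x y
reduce n (acc rec) b c x y Δ≡-3 = by-size (n ℕ.≤? m)
  where
  open Shifted (shift-into-range n b c Δ≡-3)
  N = +[1+ n ]
  x′ = proj₁ (shift x y)
  by-size : Dec (n ≤ m) → ∃₂ λ u v → form (+ 1) (- + 1) (+ 1) u v ≡ form N b c x y
  by-size (yes n≤m) = x′ , y , trans (principal-form (reduced-form n≤m r<2N disc≡-3) x′ y) (proj₂ (shift x y))
  by-size (no  n≰m) = Product.map₂ (Product.map₂ λ f₁≡f₂ → trans f₁≡f₂ (trans (form-swap N (+ r - N) +[1+ m ] x′ y) (proj₂ (shift x y))))
    (reduce m (rec (ℕ.≰⇒> n≰m)) (- (+ r - N)) N y (- x′) (trans (disc-swap N (+ r - N) +[1+ m ]) disc≡-3))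

root⇒representation : ∀ n m → +[1+ n ] ∣ m * m - m + + 1 → ∃₂ λ u v → form (+ 1) (- + 1) (+ 1) u v ≡ +[1+ n ]
root⇒representation n m (divides k m²-m+1≡kN) =
  Product.map₂ (Product.map₂ λ f≡f₁₀ → trans f≡f₁₀ (identity N (+ 2 * m - + 1) k))
    (reduce n (<-wellFounded n) (+ 2 * m - + 1) k (+ 1) (+ 0) Δ≡-3)
  where
  N = +[1+ n ]
  identity : ∀ N b c → N * + 1 * + 1 + b * + 1 * + 0 + c * + 0 * + 0 ≡ N
  identity = solve-∀
  Δ≡-3 : disc N (+ 2 * m - + 1) k ≡ - + 3
  Δ≡-3 = begin
    disc N (+ 2 * m - + 1) k                      ≡⟨ identity₁ m N k ⟩
    + 4 * (m * m - m + + 1) - + 4 * N * k - + 3   ≡⟨ cong (λ e → + 4 * e - + 4 * N * k - + 3) m²-m+1≡kN ⟩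
    + 4 * (k * N) - + 4 * N * k - + 3             ≡⟨ identity₂ k N ⟩
    - + 3                                         ∎
    where
    identity₁ : ∀ m N k → (+ 2 * m - + 1) * (+ 2 * m - + 1) - + 4 * N * k ≡ + 4 * (m * m - m + + 1) - + 4 * N * k - + 3
    identity₁ = solve-∀
    identity₂ : ∀ k N → + 4 * (k * N) - + 4 * N * k - + 3 ≡ - + 3
    identity₂ = solve-∀

norm : ℤω → ℤ
norm ⟨ u , v ⟩ = u * u - u * v + v * v

norm≡form : ∀ u v → norm ⟨ u , v ⟩ ≡ form (+ 1) (- + 1) (+ 1) u v
norm≡form = identity
  where
  identity : ∀ u v → u * u - u * v + v * v ≡ + 1 * u * u + (- + 1) * u * v + + 1 * v * v
  identity = solve-∀

root⇒norm : ∀ n m → +[1+ n ] ∣ m * m - m + + 1 → ∃ λ z → norm z ≡ +[1+ n ]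
root⇒norm n m n∣m²-m+1 =
  (λ (u , v , form≡n) → ⟨ u , v ⟩ , trans (norm≡form u v) form≡n) (root⇒representation n m n∣m²-m+1)

prime-norm : ∀ {p} → Prime p → p % 3 ≡ 1 → ∃ λ z → norm z ≡ + p
prime-norm {zero}  p-prime _       = contradiction (1<p p-prime) λ ()
prime-norm {suc n} p-prime p%3≡1 = root⇒norm n (+ proj₁ (root p-prime p%3≡1)) (proj₂ (root p-prime p%3≡1))

-- N₃ as a norm, and the two polynomial shapes at ω

conj : ℤω → ℤω
conj ⟨ u , v ⟩ = ⟨ u - v , - v ⟩

*ω-conj : ∀ z → z *ω conj z ≡ ofℤ (norm z)
*ω-conj ⟨ u , v ⟩ = cong₂ ⟨_,_⟩ (re-identity u v) (im-identity u v)
  where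
  re-identity : ∀ u v → u * (u - v) - v * (- v) ≡ u * u - u * v + v * v
  re-identity = solve-∀
  im-identity : ∀ u v → u * (- v) + v * (u - v) - v * (- v) ≡ + 0
  im-identity = solve-∀

conj-horner : ∀ c z w → conj (ofℤ c +ω z *ω w) ≡ ofℤ c +ω conj z *ω conj w
conj-horner c ⟨ x , y ⟩ ⟨ u , v ⟩ = cong₂ ⟨_,_⟩ (re-identity c x y u v) (im-identity x y u v)
  where
  re-identity : ∀ c x y u v → c + (x * u - y * v) - (+ 0 + (x * v + y * u - y * v))
                              ≡ c + ((x - y) * (u - v) - (- y) * (- v))
  re-identity = solve-∀
  im-identity : ∀ x y u v → - (+ 0 + (x * v + y * u - y * v))
                            ≡ + 0 + ((x - y) * (- v) + (- y) * (u - v) - (- y) * (- v))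
  im-identity = solve-∀

eval-conj : ∀ F z → eval F (conj z) ≡ conj (eval F z)
eval-conj []      z = refl
eval-conj (c ∷ F) z = begin
  ofℤ c +ω conj z *ω eval F (conj z)   ≡⟨ cong (λ w → ofℤ c +ω conj z *ω w) (eval-conj F z) ⟩
  ofℤ c +ω conj z *ω conj (eval F z)   ≡⟨ conj-horner c z (eval F z) ⟨
  conj (ofℤ c +ω z *ω eval F z)        ∎

N₃≡norm : ∀ F → N₃ F ≡ ofℤ (norm (eval F ω₃))
N₃≡norm F = begin
  -- ω₃ *ω ω₃ and conj ω₃ both compute to ⟨ -1 , -1 ⟩.
  eval F ω₃ *ω eval F (conj ω₃)   ≡⟨ cong (eval F ω₃ *ω_) (eval-conj F ω₃) ⟩
  eval F ω₃ *ω conj (eval F ω₃)   ≡⟨ *ω-conj (eval F ω₃) ⟩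
  ofℤ (norm (eval F ω₃))          ∎

norm-*ω : ∀ z w → norm (z *ω w) ≡ norm z * norm w
norm-*ω ⟨ a , b ⟩ ⟨ c , d ⟩ = identity a b c d
  where
  identity : ∀ a b c d →
    (a * c - b * d) * (a * c - b * d) - (a * c - b * d) * (a * d + b * c - b * d)
      + (a * d + b * c - b * d) * (a * d + b * c - b * d)
    ≡ (a * a - a * b + b * b) * (c * c - c * d + d * d)
  identity = solve-∀

norm-conj : ∀ z → norm (conj z) ≡ norm z
norm-conj ⟨ u , v ⟩ = identity u v
  where
  identity : ∀ u v → (u - v) * (u - v) - (u - v) * (- v) + (- v) * (- v) ≡ u * u - u * v + v * v
  identity = solve-∀

-- The left-hand sides below are what _⊕_, _⊗_ and eval compute, junk arithmetic included.
linear-coefficients : ∀ a b A B → C a ⊕ C b ⊗ X ⊕ C (+ 5) ⊗ (C A ⊗ X ⊕ C B) ≡ (a + + 5 * B) ∷ (b + + 5 * A) ∷ []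
linear-coefficients a b A B = cong₂ _∷_ (constant a b A B) (cong (_∷ []) (linear b A))
  where
  constant : ∀ a b A B → a + (b * + 0 + + 0) + (+ 5 * (A * + 0 + + 0 + B) + + 0) ≡ a + + 5 * B
  constant = solve-∀
  linear : ∀ b A → b * + 1 + + 5 * (A * + 1) ≡ b + + 5 * A
  linear = solve-∀

quadratic-coefficients : ∀ a b C′ D → C a ⊕ C b ⊗ X ⊕ C (+ 5) ⊗ (X ⊕ C (- + 1)) ⊗ (C C′ ⊗ X ⊕ C D)
                         ≡ (a - + 5 * D) ∷ (b + + 5 * D - + 5 * C′) ∷ + 5 * C′ ∷ []
quadratic-coefficients a b C′ D =
  cong₂ _∷_ (constant a b C′ D) (cong₂ _∷_ (linear b C′ D) (cong (_∷ []) (quadratic C′)))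
  where
  constant : ∀ a b C′ D → a + (b * + 0 + + 0) + ((+ 5 * (+ 0 + - + 1) + + 0) * (C′ * + 0 + + 0 + D) + + 0) ≡ a - + 5 * D
  constant = solve-∀
  linear : ∀ b C′ D → b * + 1 + ((+ 5 * (+ 0 + - + 1) + + 0) * (C′ * + 1) + (+ 5 * + 1 * (C′ * + 0 + + 0 + D) + + 0))
                      ≡ b + + 5 * D - + 5 * C′
  linear = solve-∀
  quadratic : ∀ C′ → + 5 * + 1 * (C′ * + 1) ≡ + 5 * C′
  quadratic = solve-∀

eval-ω₃-linear : ∀ c₀ c₁ → eval (c₀ ∷ c₁ ∷ []) ω₃ ≡ ⟨ c₀ , c₁ ⟩
eval-ω₃-linear c₀ c₁ = cong₂ ⟨_,_⟩ (re-identity c₀ c₁) (im-identity c₁)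
  where
  re-identity : ∀ c₀ c₁ → c₀ + (+ 0 * (c₁ + + 0) - + 1 * + 0) ≡ c₀
  re-identity = solve-∀
  im-identity : ∀ c₁ → + 0 + (+ 0 * + 0 + + 1 * (c₁ + + 0) - + 1 * + 0) ≡ c₁
  im-identity = solve-∀

eval-ω₃-quadratic : ∀ c₀ c₁ c₂ → eval (c₀ ∷ c₁ ∷ c₂ ∷ []) ω₃ ≡ ⟨ c₀ - c₂ , c₁ - c₂ ⟩
eval-ω₃-quadratic c₀ c₁ c₂ = cong₂ ⟨_,_⟩ (re-identity c₀ c₁ c₂) (im-identity c₁ c₂)
  where
  re-identity : ∀ c₀ c₁ c₂ →
    c₀ + (+ 0 * (c₁ + (+ 0 * (c₂ + + 0) - + 1 * + 0)) - + 1 * (+ 0 + (+ 0 * + 0 + + 1 * (c₂ + + 0) - + 1 * + 0)))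
      ≡ c₀ - c₂
  re-identity = solve-∀
  im-identity : ∀ c₁ c₂ →
    + 0 + (+ 0 * (+ 0 + (+ 0 * + 0 + + 1 * (c₂ + + 0) - + 1 * + 0)) + + 1 * (c₁ + (+ 0 * (c₂ + + 0) - + 1 * + 0))
      - + 1 * (+ 0 + (+ 0 * + 0 + + 1 * (c₂ + + 0) - + 1 * + 0)))
      ≡ c₁ - c₂
  im-identity = solve-∀

N₃-linear : ∀ a b A B → N₃ (C a ⊕ C b ⊗ X ⊕ C (+ 5) ⊗ (C A ⊗ X ⊕ C B)) ≡ ofℤ (norm ⟨ a + + 5 * B , b + + 5 * A ⟩)
N₃-linear a b A B = begin
  N₃ F                                          ≡⟨ N₃≡norm F ⟩
  ofℤ (norm (eval F ω₃))                        ≡⟨ cong (λ G → ofℤ (norm (eval G ω₃))) (linear-coefficients a b A B) ⟩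
  ofℤ (norm (eval (a + + 5 * B ∷ b + + 5 * A ∷ []) ω₃)) ≡⟨ cong (λ z → ofℤ (norm z)) (eval-ω₃-linear (a + + 5 * B) (b + + 5 * A)) ⟩
  ofℤ (norm ⟨ a + + 5 * B , b + + 5 * A ⟩)      ∎
  where
  F = C a ⊕ C b ⊗ X ⊕ C (+ 5) ⊗ (C A ⊗ X ⊕ C B)

N₃-quadratic : ∀ a b C′ D → N₃ (C a ⊕ C b ⊗ X ⊕ C (+ 5) ⊗ (X ⊕ C (- + 1)) ⊗ (C C′ ⊗ X ⊕ C D))
               ≡ ofℤ (norm ⟨ a - + 5 * D - + 5 * C′ , b + + 5 * D - + 5 * C′ - + 5 * C′ ⟩)
N₃-quadratic a b C′ D = begin
  N₃ F                                          ≡⟨ N₃≡norm F ⟩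
  ofℤ (norm (eval F ω₃))                        ≡⟨ cong (λ G → ofℤ (norm (eval G ω₃))) (quadratic-coefficients a b C′ D) ⟩
  ofℤ (norm (eval (a - + 5 * D ∷ b + + 5 * D - + 5 * C′ ∷ + 5 * C′ ∷ []) ω₃)) ≡⟨ cong (λ z → ofℤ (norm z)) (eval-ω₃-quadratic (a - + 5 * D) (b + + 5 * D - + 5 * C′) (+ 5 * C′)) ⟩
  ofℤ (norm ⟨ a - + 5 * D - + 5 * C′ , b + + 5 * D - + 5 * C′ - + 5 * C′ ⟩) ∎
  where
  F = C a ⊕ C b ⊗ X ⊕ C (+ 5) ⊗ (X ⊕ C (- + 1)) ⊗ (C C′ ⊗ X ⊕ C D)

infix 4 _≈_mod_ _≈_mod5[1-ω] _≈?_mod_ _≈?_mod5[1-ω]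

_≈_mod_ : ℤω → ℤω → ℤ → Set
z ≈ w mod n = (n ∣ re z - re w) × (n ∣ im z - im w)

_≈?_mod_ : ∀ z w n → Dec (z ≈ w mod n)
z ≈? w mod n = (n ∣? re z - re w) ×-dec (n ∣? im z - im w)

-- 5(1 - ω)ℤ[ω] is the lattice of those ⟨ x , y ⟩ with 5 ∣ x and 15 ∣ x + y.
_≈_mod5[1-ω] : ℤω → ℤω → Set
z ≈ w mod5[1-ω] = (+ 5 ∣ re z - re w) × (+ 15 ∣ (re z - re w) + (im z - im w))

_≈?_mod5[1-ω] : ∀ z w → Dec (z ≈ w mod5[1-ω])
z ≈? w mod5[1-ω] = (+ 5 ∣? re z - re w) ×-dec (+ 15 ∣? (re z - re w) + (im z - im w))

≈-residues : ∀ z d .{{_ : NonZero d}} → z ≈ ⟨ + (re z %ℕ d) , + (im z %ℕ d) ⟩ mod + d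
≈-residues z d = ∣-residue (re z) d , ∣-residue (im z) d

*ω-congˡ : ∀ {n z w} ε → z ≈ w mod n → ε *ω z ≈ ε *ω w mod n
*ω-congˡ {z = ⟨ u , v ⟩} {⟨ u′ , v′ ⟩} ⟨ a , b ⟩ (n∣u-u′ , n∣v-v′) =
    ∣-combination n∣u-u′ n∣v-v′ a (- b) (re-identity a b u v u′ v′)
  , ∣-combination n∣u-u′ n∣v-v′ b (a - b) (im-identity a b u v u′ v′)
  where
  re-identity : ∀ a b u v u′ v′ → (a * u - b * v) - (a * u′ - b * v′) ≡ a * (u - u′) + (- b) * (v - v′)
  re-identity = solve-∀
  im-identity : ∀ a b u v u′ v′ → (a * v + b * u - b * v) - (a * v′ + b * u′ - b * v′) ≡ b * (u - u′) + (a - b) * (v - v′)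
  im-identity = solve-∀

conj-cong : ∀ {n z w} → z ≈ w mod n → conj z ≈ conj w mod n
conj-cong {z = ⟨ u , v ⟩} {⟨ u′ , v′ ⟩} (n∣u-u′ , n∣v-v′) =
    ∣-combination n∣u-u′ n∣v-v′ (+ 1) (- + 1) (re-identity u v u′ v′)
  , ∣-combination n∣u-u′ n∣v-v′ (+ 0) (- + 1) (im-identity u v u′ v′)
  where
  re-identity : ∀ u v u′ v′ → (u - v) - (u′ - v′) ≡ + 1 * (u - u′) + (- + 1) * (v - v′)
  re-identity = solve-∀
  im-identity : ∀ u v u′ v′ → - v - - v′ ≡ + 0 * (u - u′) + (- + 1) * (v - v′)
  im-identity = solve-∀

norm-cong : ∀ {n z w} → z ≈ w mod n → n ∣ norm z - norm w
norm-cong {z = ⟨ u , v ⟩} {⟨ u′ , v′ ⟩} (n∣u-u′ , n∣v-v′) =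
  ∣-combination n∣u-u′ n∣v-v′ (u + u′ - v) (v + v′ - u′) (identity u v u′ v′)
  where
  identity : ∀ u v u′ v′ → (u * u - u * v + v * v) - (u′ * u′ - u′ * v′ + v′ * v′)
                           ≡ (u + u′ - v) * (u - u′) + (v + v′ - u′) * (v - v′)
  identity = solve-∀

5∣15 : + 5 ∣ + 15
5∣15 = divides (+ 3) refl

≈mod5-resp : ∀ {z w α} → z ≈ w mod + 15 → w ≈ α mod + 5 → z ≈ α mod + 5
≈mod5-resp {z} {w} {α} (15∣re , 15∣im) (5∣re , 5∣im) =
    ∣-combination (∣-trans 5∣15 15∣re) 5∣re (+ 1) (+ 1) (split (re z) (re w) (re α))
  , ∣-combination (∣-trans 5∣15 15∣im) 5∣im (+ 1) (+ 1) (split (im z) (im w) (im α))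
  where
  split : ∀ z w α → z - α ≡ + 1 * (z - w) + + 1 * (w - α)
  split = solve-∀

≈mod5[1-ω]-resp : ∀ {z w α} → z ≈ w mod + 15 → w ≈ α mod5[1-ω] → z ≈ α mod5[1-ω]
≈mod5[1-ω]-resp {z} {w} {α} (15∣re , 15∣im) (5∣re , 15∣sum) =
    ∣-combination (∣-trans 5∣15 15∣re) 5∣re (+ 1) (+ 1) (split (re z) (re w) (re α))
  , ∣-combination (∣m∣n⇒∣m+n 15∣re 15∣im) 15∣sum (+ 1) (+ 1) (split₂ (re z) (re w) (re α) (im z) (im w) (im α))
  where
  split : ∀ z w α → z - α ≡ + 1 * (z - w) + + 1 * (w - α)
  split = solve-∀
  split₂ : ∀ x x′ a y y′ b → (x - a) + (y - b) ≡ + 1 * ((x - x′) + (y - y′)) + + 1 * ((x′ - a) + (y′ - b))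
  split₂ = solve-∀

-- Associates modulo 15

unit : Fin 6 → ℤω
unit 0F = ⟨ + 1 , + 0 ⟩
unit 1F = ⟨ + 1 , + 1 ⟩
unit 2F = ⟨ + 0 , + 1 ⟩
unit 3F = ⟨ - + 1 , + 0 ⟩
unit 4F = ⟨ - + 1 , - + 1 ⟩
unit 5F = ⟨ + 0 , - + 1 ⟩

norm-unit : ∀ k → norm (unit k) ≡ + 1
norm-unit 0F = refl
norm-unit 1F = refl
norm-unit 2F = refl
norm-unit 3F = refl
norm-unit 4F = refl
norm-unit 5F = refl

associate : Fin 6 → Bool → ℤω → ℤω
associate k false z = unit k *ω z
associate k true  z = unit k *ω conj z

norm-associate : ∀ k c z → norm (associate k c z) ≡ norm z
norm-associate k false z = trans (norm-*ω (unit k) z) (trans (cong (_* norm z) (norm-unit k)) (ℤ.*-identityˡ (norm z)))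
norm-associate k true  z = trans (norm-*ω (unit k) (conj z)) (trans (cong (_* norm (conj z)) (norm-unit k))
                             (trans (ℤ.*-identityˡ (norm (conj z))) (norm-conj z)))

associate-cong : ∀ {n z w} k c → z ≈ w mod n → associate k c z ≈ associate k c w mod n
associate-cong k false z≈w        = *ω-congˡ (unit k) z≈w
associate-cong {z = z} {w} k true z≈w = *ω-congˡ (unit k) (conj-cong {z = z} {w} z≈w)

HasAssociate : (ℤω → Set) → ℤω → Set
HasAssociate P z = ∃₂ λ k c → P (associate k c z)

hasAssociate? : ∀ {P} → Decidable P → Decidable (HasAssociate P)
hasAssociate? P? z = map′ (λ (k , c , Pk) → k , c , Pk) (λ (k , c , Pk) → k , c , Pk)
  (any? λ k → map′ from-⊎ to-⊎ (P? (associate k false z) ⊎-dec P? (associate k true z)))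
  where
  from-⊎ : ∀ {Q : Bool → Set} → Q false ⊎ Q true → ∃ Q
  from-⊎ (inj₁ q) = false , q
  from-⊎ (inj₂ q) = true , q
  to-⊎ : ∀ {Q : Bool → Set} → ∃ Q → Q false ⊎ Q true
  to-⊎ (false , q) = inj₁ q
  to-⊎ (true , q) = inj₂ q

ResidueAssociates : (ℤω → Set) → ℤ → Set
ResidueAssociates P N =
  ∀ {i} → i < 15 → ∀ {j} → j < 15 → + 15 ∣ norm ⟨ + i , + j ⟩ - N → HasAssociate P ⟨ + i , + j ⟩

residueAssociates? : ∀ {P} → Decidable P → ∀ N → Dec (ResidueAssociates P N)
residueAssociates? P? N =
  ℕ.allUpTo? (λ i → ℕ.allUpTo? (λ j → (+ 15 ∣? norm ⟨ + i , + j ⟩ - N) →-dec hasAssociate? P? ⟨ + i , + j ⟩) 15) 15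

has-associate : ∀ {P N} → (∀ {z w} → z ≈ w mod + 15 → P w → P z) → ResidueAssociates P N →
                ∀ z → + 15 ∣ norm z - N → HasAssociate P z
has-associate {P} {N} P-resp residues z 15∣Nz-N = k , c , P-resp (associate-cong k c z≈z₀) Pz₀
  where
  z₀ = ⟨ + (re z %ℕ 15) , + (im z %ℕ 15) ⟩
  z≈z₀ : z ≈ z₀ mod + 15
  z≈z₀ = ≈-residues z 15
  15∣Nz₀-N : + 15 ∣ norm z₀ - N
  15∣Nz₀-N = ∣-combination 15∣Nz-N (norm-cong {z = z} {z₀} z≈z₀) (+ 1) (- + 1) (identity (norm z₀) (norm z) N)
    where
    identity : ∀ a b N → a - N ≡ + 1 * (b - N) + (- + 1) * (b - a)
    identity = solve-∀
  k = proj₁ (residues (n%ℕd<d (re z) 15) (n%ℕd<d (im z) 15) 15∣Nz₀-N)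
  c = proj₁ (proj₂ (residues (n%ℕd<d (re z) 15) (n%ℕd<d (im z) 15) 15∣Nz₀-N))
  Pz₀ = proj₂ (proj₂ (residues (n%ℕd<d (re z) 15) (n%ℕd<d (im z) 15) 15∣Nz₀-N))

≈mod5⇒linear : ∀ {a b z} → z ≈ ⟨ a , b ⟩ mod + 5 → ∃₂ λ A B → ⟨ a + + 5 * B , b + + 5 * A ⟩ ≡ z
≈mod5⇒linear {a} {b} {⟨ x , y ⟩} (divides B x-a≡B*5 , divides A y-b≡A*5) =
  A , B , cong₂ ⟨_,_⟩ (offset a x B x-a≡B*5) (offset b y A y-b≡A*5)
  where
  offset : ∀ a x q → x - a ≡ q * + 5 → a + + 5 * q ≡ x
  offset a x q x-a≡q*5 = begin
    a + + 5 * q   ≡⟨ cong (_+_ a) (ℤ.*-comm (+ 5) q) ⟩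
    a + q * + 5   ≡⟨ cong (_+_ a) x-a≡q*5 ⟨
    a + (x - a)   ≡⟨ cancel a x ⟩
    x             ∎
    where
    cancel : ∀ a x → a + (x - a) ≡ x
    cancel = solve-∀

≈mod5[1-ω]⇒quadratic : ∀ {a b z} → z ≈ ⟨ a , b ⟩ mod5[1-ω] →
                       ∃₂ λ C′ D → ⟨ a - + 5 * D - + 5 * C′ , b + + 5 * D - + 5 * C′ - + 5 * C′ ⟩ ≡ z
≈mod5[1-ω]⇒quadratic {a} {b} {⟨ x , y ⟩} (divides s x-a≡s*5 , divides w sum≡w*15) =
  - w , w - s , cong₂ ⟨_,_⟩ re≡x im≡y
  where
  re≡x : a - + 5 * (w - s) - + 5 * (- w) ≡ x
  re≡x = begin
    a - + 5 * (w - s) - + 5 * (- w)   ≡⟨ identity₁ a w s ⟩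
    a + s * + 5                       ≡⟨ cong (_+_ a) x-a≡s*5 ⟨
    a + (x - a)                       ≡⟨ identity₂ a x ⟩
    x                                 ∎
    where
    identity₁ : ∀ a w s → a - + 5 * (w - s) - + 5 * (- w) ≡ a + s * + 5
    identity₁ = solve-∀
    identity₂ : ∀ a x → a + (x - a) ≡ x
    identity₂ = solve-∀
  im≡y : b + + 5 * (w - s) - + 5 * (- w) - + 5 * (- w) ≡ y
  im≡y = begin
    b + + 5 * (w - s) - + 5 * (- w) - + 5 * (- w)   ≡⟨ identity₁ b w s ⟩
    b + w * + 15 - s * + 5                          ≡⟨ cong₂ (λ e f → b + e - f) sum≡w*15 x-a≡s*5 ⟨
    b + ((x - a) + (y - b)) - (x - a)               ≡⟨ identity₂ a b x y ⟩
    y                                               ∎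
    where
    identity₁ : ∀ b w s → b + + 5 * (w - s) - + 5 * (- w) - + 5 * (- w) ≡ b + w * + 15 - s * + 5
    identity₁ = solve-∀
    identity₂ : ∀ a b x y → b + ((x - a) + (y - b)) - (x - a) ≡ y
    identity₂ = solve-∀

%≡⇒∣ : ∀ {p n r} .{{_ : NonZero n}} → p % n ≡ r → + n ∣ + p - + r
%≡⇒∣ {p} {n} {r} p%n≡r = divides (+ (p / n)) (begin
  + p - + r                          ≡⟨ cong (λ m → + m - + r) (trans (m≡m%n+[m/n]*n p n) (cong (ℕ._+ (p / n) ℕ.* n) p%n≡r)) ⟩
  + (r ℕ.+ p / n ℕ.* n) - + r        ≡⟨ cong (_- + r) (trans (ℤ.pos-+ r (p / n ℕ.* n)) (cong (_+_ (+ r)) (ℤ.pos-* (p / n) n))) ⟩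
  + r + + (p / n) * + n - + r        ≡⟨ cancel (+ r) (+ (p / n) * + n) ⟩
  + (p / n) * + n                    ∎)
  where
  cancel : ∀ a b → a + b - a ≡ b
  cancel = solve-∀

-- The implicit certificate is discharged by running the decision procedure on all 225 residue pairs.
linear-case : ∀ a b r {_ : True (residueAssociates? (λ w → w ≈? ⟨ a , b ⟩ mod + 5) (+ r))} {p} z →
              norm z ≡ + p → p % 15 ≡ r → ∃₂ λ A B → N₃ (C a ⊕ C b ⊗ X ⊕ C (+ 5) ⊗ (C A ⊗ X ⊕ C B)) ≡ ofℤ (+ p)
linear-case a b r {certificate} {p} z Nz≡p p%15≡r =
  from-associate (has-associate (λ {z} {w} → ≈mod5-resp {z} {w} {⟨ a , b ⟩}) (toWitness certificate) z (subst (λ n → + 15 ∣ n - + r) (sym Nz≡p) (%≡⇒∣ p%15≡r)))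
  where
  from-associate : HasAssociate (λ w → w ≈ ⟨ a , b ⟩ mod + 5) z →
                   ∃₂ λ A B → N₃ (C a ⊕ C b ⊗ X ⊕ C (+ 5) ⊗ (C A ⊗ X ⊕ C B)) ≡ ofℤ (+ p)
  from-associate (k , c , z′≈α) = from-coefficients (≈mod5⇒linear z′≈α)
    where
    from-coefficients : (∃₂ λ A B → ⟨ a + + 5 * B , b + + 5 * A ⟩ ≡ associate k c z) →
                        ∃₂ λ A B → N₃ (C a ⊕ C b ⊗ X ⊕ C (+ 5) ⊗ (C A ⊗ X ⊕ C B)) ≡ ofℤ (+ p)
    from-coefficients (A , B , α+5q≡z′) = A , B , (begin
      N₃ (C a ⊕ C b ⊗ X ⊕ C (+ 5) ⊗ (C A ⊗ X ⊕ C B)) ≡⟨ N₃-linear a b A B ⟩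
      ofℤ (norm ⟨ a + + 5 * B , b + + 5 * A ⟩)        ≡⟨ cong (λ w → ofℤ (norm w)) α+5q≡z′ ⟩
      ofℤ (norm (associate k c z))                     ≡⟨ cong ofℤ (trans (norm-associate k c z) Nz≡p) ⟩
      ofℤ (+ p)                                        ∎)

quadratic-case : ∀ a b r {_ : True (residueAssociates? (λ w → w ≈? ⟨ a , b ⟩ mod5[1-ω]) (+ r))} {p} z →
                 norm z ≡ + p → p % 15 ≡ r →
                 ∃₂ λ C′ D → N₃ (C a ⊕ C b ⊗ X ⊕ C (+ 5) ⊗ (X ⊕ C (- + 1)) ⊗ (C C′ ⊗ X ⊕ C D)) ≡ ofℤ (+ p)
quadratic-case a b r {certificate} {p} z Nz≡p p%15≡r =
  from-associate (has-associate (λ {z} {w} → ≈mod5[1-ω]-resp {z} {w} {⟨ a , b ⟩}) (toWitness certificate) z (subst (λ n → + 15 ∣ n - + r) (sym Nz≡p) (%≡⇒∣ p%15≡r)))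
  where
  from-associate : HasAssociate (λ w → w ≈ ⟨ a , b ⟩ mod5[1-ω]) z →
                   ∃₂ λ C′ D → N₃ (C a ⊕ C b ⊗ X ⊕ C (+ 5) ⊗ (X ⊕ C (- + 1)) ⊗ (C C′ ⊗ X ⊕ C D)) ≡ ofℤ (+ p)
  from-associate (k , c , z′≈α) = from-coefficients (≈mod5[1-ω]⇒quadratic z′≈α)
    where
    from-coefficients : (∃₂ λ C′ D → ⟨ a - + 5 * D - + 5 * C′ , b + + 5 * D - + 5 * C′ - + 5 * C′ ⟩ ≡ associate k c z) →
                        ∃₂ λ C′ D → N₃ (C a ⊕ C b ⊗ X ⊕ C (+ 5) ⊗ (X ⊕ C (- + 1)) ⊗ (C C′ ⊗ X ⊕ C D)) ≡ ofℤ (+ p)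
    from-coefficients (C′ , D , α+5[ω-1]q≡z′) = C′ , D , (begin
      N₃ (C a ⊕ C b ⊗ X ⊕ C (+ 5) ⊗ (X ⊕ C (- + 1)) ⊗ (C C′ ⊗ X ⊕ C D))
        ≡⟨ N₃-quadratic a b C′ D ⟩
      ofℤ (norm ⟨ a - + 5 * D - + 5 * C′ , b + + 5 * D - + 5 * C′ - + 5 * C′ ⟩)
        ≡⟨ cong (λ w → ofℤ (norm w)) α+5[ω-1]q≡z′ ⟩
      ofℤ (norm (associate k c z))
        ≡⟨ cong ofℤ (trans (norm-associate k c z) Nz≡p) ⟩
      ofℤ (+ p) ∎)

lemma8 : (p : ℕ) → Prime p → p % 3 ≡ 1 →
    ((p % 15 ≡ 1 → ∃₂ λ A B → N₃ (C (+ 1) ⊕ C (+ 0) ⊗ X ⊕ C (+ 5) ⊗ (C A ⊗ X ⊕ C B)) ≡ ofℤ (+ p))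
    × (p % 15 ≡ 4 → ∃₂ λ A B → N₃ (C (+ 2) ⊕ C (+ 0) ⊗ X ⊕ C (+ 5) ⊗ (C A ⊗ X ⊕ C B)) ≡ ofℤ (+ p))
    × (p % 15 ≡ 7 → ∃₂ λ A B → N₃ (C (+ 3) ⊕ C (+ 1) ⊗ X ⊕ C (+ 5) ⊗ (C A ⊗ X ⊕ C B)) ≡ ofℤ (+ p))
    × (p % 15 ≡ 13 → ∃₂ λ A B → N₃ (C (+ 4) ⊕ C (+ 3) ⊗ X ⊕ C (+ 5) ⊗ (C A ⊗ X ⊕ C B)) ≡ ofℤ (+ p)))
    × (p % 15 ≡ 7 → ∃₂ λ C′ D → N₃ (C (+ 2) ⊕ C (+ 3) ⊗ X ⊕ C (+ 5) ⊗ (X ⊕ C (- + 1)) ⊗ (C C′ ⊗ X ⊕ C D)) ≡ ofℤ (+ p))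
    × (p % 15 ≡ 13 → ∃₂ λ C′ D → N₃ (C (+ 3) ⊕ C (- + 1) ⊗ X ⊕ C (+ 5) ⊗ (X ⊕ C (- + 1)) ⊗ (C C′ ⊗ X ⊕ C D)) ≡ ofℤ (+ p))
lemma8 p p-prime p%3≡1 =
    ( linear-case (+ 1) (+ 0) 1 z Nz≡p
    , linear-case (+ 2) (+ 0) 4 z Nz≡p
    , linear-case (+ 3) (+ 1) 7 z Nz≡p
    , linear-case (+ 4) (+ 3) 13 z Nz≡p )
  , quadratic-case (+ 2) (+ 3) 7 z Nz≡p
  , quadratic-case (+ 3) (- + 1) 13 z Nz≡p
  where
  z = proj₁ (prime-norm p-prime p%3≡1)
  Nz≡p = proj₂ (prime-norm p-prime p%3≡1)
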